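{- Let $d$ be a degree sequence and let $n\ge 4$. If $R_1,\dots,R_n$ are the (distinct) vertices of a clique in the realization graph $\mathcal{G}(d)$, then a dial $(W,P)$ exists with respect to $\{R_1,\dots,R_n\}$. Moreover, for all distinct $i,j\in\{1,\dots,n\}$, the dial configuration in $R_i$ (the vertex set $W$ together with the edges and non-edges of $R_i$ among the pairs in $P$) contains an alternating 4-cycle on which a 2-switch converts $R_i$ into $R_j$.
   Context: All graphs are finite and simple. A labeled realization of a degree sequence $d=(d_1,\dots,d_n)$ is a graph on the fixed vertex set $\{v_1,\dots,v_n\}$ in which $v_i$ has degree $d_i$. An alternating 4-cycle $[u,v:w,x]$ in a graph $H$ consists of four distinct vertices $u,v,w,x$ with $uv,wx\in E(H)$ and $ux,vw\notin E(H)$ (nothing is required of the pairs $\{u,w\},\{v,x\}$). A 2-switch on it deletes $uv,wx$ and adds $ux,vw$. The realization graph $\mathcal{G}(d)$ has the labeled realizations of $d$ as vertices, two being adjacent when one is obtained from the other by a single 2-switch. Dial: given a set $\mathcal{S}=\{R_1,\dots,R_n\}$ of labeled realizations of the same degree sequence on a common vertex set $V$, a dial with respect to $\mathcal{S}$ is a pair $(W,P)$ such that: (a) $P$ is the set of all pairs $\{a,b\}\subseteq V$ that are an edge in some $R_i$ and a non-edge in some $R_j$, and $W$ is the union of the pairs in $P$; (b) there are two vertices $u,v\in W$ such that $P$ consists exactly of the pairs $\{u,w\}$ and $\{v,w\}$ for $w\in W\setminus\{u,v\}$; (c) in every $R_i$, $u$ is adjacent to exactly one vertex $w_i$ of $W\setminus\{u,v\}$,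 and $v$ is non-adjacent to $w_i$ but adjacent to every vertex of $W\setminus\{u,v,w_i\}$. -}

module Defs where

open import Data.Nat using (ℕ; zero; suc; _+_)
open import Data.Bool using (Bool; true; false; if_then_else_; _∧_; _∨_)
open import Data.Fin using (Fin)
open import Data.Fin.Properties using (_≟_)
open import Data.List using (List; map; allFin)
open import Data.Nat.ListAction using (sum)
open import Data.Product using (Σ; ∃; ∃-syntax; _×_; _,_)
open import Data.Sum using (_⊎_)
open import Relation.Nullary using (¬_)
open import Relation.Nullary.Decidable using (⌊_⌋)
open import Relation.Binary.PropositionalEquality using (_≡_; _≢_)
open import Function.Bundles using (_⇔_)

record Graph (m : ℕ) : Set where
  field
    adj    : Fin m → Fin m → Bool
    sym    : ∀ a b → adj a b ≡ adj b a
    irrefl : ∀ a → adj a a ≡ false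
open Graph public

SameGraph : ∀ {m} → Graph m → Graph m → Set
SameGraph G H = ∀ a b → adj G a b ≡ adj H a b

degree : ∀ {m} → Graph m → Fin m → ℕ
degree {m} G a = sum (map (λ b → if adj G a b then 1 else 0) (allFin m))

Realizes : ∀ {m} → Graph m → (Fin m → ℕ) → Set
Realizes {m} G d = ∀ a → degree G a ≡ d a

samePair : ∀ {m} → Fin m → Fin m → Fin m → Fin m → Bool
samePair a b p q = (⌊ a ≟ p ⌋ ∧ ⌊ b ≟ q ⌋) ∨ (⌊ a ≟ q ⌋ ∧ ⌊ b ≟ p ⌋)

Distinct4 : ∀ {m} → Fin m → Fin m → Fin m → Fin m → Set
Distinct4 u v w x = u ≢ v × u ≢ w × u ≢ x × v ≢ w × v ≢ x × w ≢ x

Alt4 : ∀ {m} → Graph m → Fin m → Fin m → Fin m → Fin m → Set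
Alt4 H u v w x =
  Distinct4 u v w x × adj H u v ≡ true × adj H w x ≡ true
  × adj H u x ≡ false × adj H v w ≡ false

switchAdj : ∀ {m} → Graph m → Fin m → Fin m → Fin m → Fin m → Fin m → Fin m → Bool
switchAdj H u v w x a b =
  if samePair a b u v ∨ samePair a b w x then false
  else if samePair a b u x ∨ samePair a b v w then true
  else adj H a b

SwitchTo : ∀ {m} → Graph m → Graph m → Fin m → Fin m → Fin m → Fin m → Set
SwitchTo H H' u v w x = Alt4 H u v w x × (∀ a b → adj H' a b ≡ switchAdj H u v w x a b)

TwoSwitchAdjacent : ∀ {m} → Graph m → Graph m → Set
TwoSwitchAdjacent H H' = ∃[ u ] ∃[ v ] ∃[ w ] ∃[ x ] SwitchTo H H' u v w x

CliqueOfRealizations : ∀ {m n} → (Fin m → ℕ) → (Fin n → Graph m) → Set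
CliqueOfRealizations d R =
  (∀ i → Realizes (R i) d)
  × (∀ i j → i ≢ j → ¬ SameGraph (R i) (R j))
  × (∀ i j → i ≢ j → TwoSwitchAdjacent (R i) (R j))

InP : ∀ {m n} → (Fin n → Graph m) → Fin m → Fin m → Set
InP R a b = (∃[ i ] adj (R i) a b ≡ true) × (∃[ j ] adj (R j) a b ≡ false)

InW : ∀ {m n} → (Fin n → Graph m) → Fin m → Set
InW R a = ∃[ b ] InP R a b

InWminus : ∀ {m n} → (Fin n → Graph m) → Fin m → Fin m → Fin m → Set
InWminus R u v w = InW R w × w ≢ u × w ≢ v

-- (W,P) (determined by R via (a)) is a dial with hub vertices u, v: (b) and (c)
IsDial : ∀ {m n} → (Fin n → Graph m) → Fin m → Fin m → Set
IsDial R u v =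
  InW R u × InW R v × u ≢ v
  × (∀ a b → InP R a b ⇔
       (∃[ w ] InWminus R u v w × (samePair a b u w ≡ true ⊎ samePair a b v w ≡ true)))
  × (∀ i → ∃[ w ] (InWminus R u v w
       × adj (R i) u w ≡ true
       × (∀ w' → InWminus R u v w' → w' ≢ w → adj (R i) u w' ≡ false)
       × adj (R i) v w ≡ false
       × (∀ w' → InWminus R u v w' → w' ≢ w → adj (R i) v w' ≡ true)))

DialExists : ∀ {m n} → (Fin n → Graph m) → Set
DialExists R = ∃[ u ] ∃[ v ] IsDial R u v

SwitchInDial : ∀ {m n} → (Fin n → Graph m) → Fin n → Fin n → Set
SwitchInDial R i j =
  ∃[ u ] ∃[ v ] ∃[ w ] ∃[ x ]
    (InW R u × InW R v × InW R w × InW R x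
     × InP R u v × InP R w x × InP R u x × InP R v w
     × SwitchTo (R i) (R j) u v w x)

{-# OPTIONS --safe #-}
-- Encode a 2-switch by the quadrangle (4-cycle) of pairs it toggles, and write every R (suc l) as
-- R 0 with the sides of an alternating quadrangle T l toggled. As R i and R j are one 2-switch apart,
-- the edge sets of T i and T j differ by a quadrangle, so they share two sides. Opposite shared sides
-- are impossible in the presence of a third realization: some corner of its quadrangle would meet two
-- sides of equal adjacency in R 0. So any two of the T l share a path of length two, and with at least
-- three of them all are quadrangles u y v t l through one path u y v. Then R 0 joins u to y, R (suc l)
-- joins u to t l, each R i joins v to every spoke except that of u, and every changing pair is a side
-- of some u y v t l: this is the dial.
module Submission where

open import Defs hiding (sym)
open import Data.Nat using (ℕ; _+_; _≥_; s≤s)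
open import Data.Fin using (Fin; zero; suc)
open import Data.Fin.Properties using (_≟_; suc-injective)
open import Data.Bool using (Bool; true; false; not; _∨_; _xor_; if_then_else_)
open import Data.Bool.Properties using (∨-zeroʳ; ¬-not; xor-same; xor-assoc; xor-comm; xor-identityʳ)
open import Data.Product using (_×_; _,_; proj₁; ∃-syntax)
open import Data.Sum using (_⊎_; inj₁; inj₂; [_,_])
open import Data.Empty using (⊥; ⊥-elim)
open import Function.Base using (_∘_)
open import Relation.Nullary using (¬_; yes; no)
open import Relation.Nullary.Decidable using (⌊_⌋)
open import Relation.Binary.PropositionalEquality
  using (_≡_; _≢_; refl; sym; trans; cong; cong₂; ≢-sym; module ≡-Reasoning)
open import Function.Bundles using (mk⇔)

false≢true : false ≢ true
false≢true ()

∨-true : ∀ {a b : Bool} → a ∨ b ≡ true → a ≡ true ⊎ b ≡ true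
∨-true {true}  _ = inj₁ refl
∨-true {false} e = inj₂ e

∨-trueˡ : ∀ {a : Bool} (b : Bool) → a ≡ true → a ∨ b ≡ true
∨-trueˡ b refl = refl

∨-trueʳ : ∀ (a : Bool) {b : Bool} → b ≡ true → a ∨ b ≡ true
∨-trueʳ true  _ = refl
∨-trueʳ false e = e

bool-ext : ∀ {a b : Bool} → (a ≡ true → b ≡ true) → (b ≡ true → a ≡ true) → a ≡ b
bool-ext {true}  {true}  _ _ = refl
bool-ext {true}  {false} f _ = sym (f refl)
bool-ext {false} {true}  _ g = g refl
bool-ext {false} {false} _ _ = refl

xor-cancelˡ : ∀ g a b → g xor a ≡ g xor b → a ≡ b
xor-cancelˡ true  true  true  _  = refl
xor-cancelˡ true  false false _  = refl
xor-cancelˡ false _     _     eq = eq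

module _ {m : ℕ} where

  SamePair : Fin m → Fin m → Fin m → Fin m → Set
  SamePair x y a b = (x ≡ a × y ≡ b) ⊎ (x ≡ b × y ≡ a)

  ⌊≟⌋-refl : ∀ (a : Fin m) → ⌊ a ≟ a ⌋ ≡ true
  ⌊≟⌋-refl a with a ≟ a
  ... | yes _ = refl
  ... | no a≢a = ⊥-elim (a≢a refl)

  samePair⇒SamePair : ∀ {x y a b : Fin m} → samePair x y a b ≡ true → SamePair x y a b
  samePair⇒SamePair {x} {y} {a} {b} e with x ≟ a | y ≟ b | x ≟ b | y ≟ a
  ... | yes p | yes q | _     | _     = inj₁ (p , q)
  ... | _     | _     | yes p | yes q = inj₂ (p , q)
  ... | no _  | _     | no _  | _     = ⊥-elim (false≢true e)
  ... | no _  | _     | yes _ | no _  = ⊥-elim (false≢true e)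
  ... | yes _ | no _  | no _  | _     = ⊥-elim (false≢true e)
  ... | yes _ | no _  | yes _ | no _  = ⊥-elim (false≢true e)

  SamePair⇒samePair : ∀ {x y a b : Fin m} → SamePair x y a b → samePair x y a b ≡ true
  SamePair⇒samePair {x} {y} (inj₁ (refl , refl)) rewrite ⌊≟⌋-refl x | ⌊≟⌋-refl y = refl
  SamePair⇒samePair {x} {y} (inj₂ (refl , refl)) rewrite ⌊≟⌋-refl x | ⌊≟⌋-refl y = ∨-zeroʳ _

  SamePair-swapʳ : ∀ {x y a b : Fin m} → SamePair x y a b → SamePair x y b a
  SamePair-swapʳ (inj₁ (p , q)) = inj₂ (p , q)
  SamePair-swapʳ (inj₂ (p , q)) = inj₁ (p , q)

  SamePair-swapˡ : ∀ {x y a b : Fin m} → SamePair x y a b → SamePair y x a b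
  SamePair-swapˡ (inj₁ (p , q)) = inj₂ (q , p)
  SamePair-swapˡ (inj₂ (p , q)) = inj₁ (q , p)

  samePair-swapʳ : ∀ x y a b → samePair {m} x y a b ≡ samePair x y b a
  samePair-swapʳ x y a b =
    bool-ext (λ h → SamePair⇒samePair (SamePair-swapʳ (samePair⇒SamePair {x} {y} {a} {b} h)))
             (λ h → SamePair⇒samePair (SamePair-swapʳ (samePair⇒SamePair {x} {y} {b} {a} h)))

  adj-SamePair : ∀ (G : Graph m) {x y a b} → SamePair x y a b → adj G x y ≡ adj G a b
  adj-SamePair G     (inj₁ (refl , refl)) = refl
  adj-SamePair G {x} {y} (inj₂ (refl , refl)) = Graph.sym G x y

  record Quad : Set where
    constructor quad
    field corner₁ corner₂ corner₃ corner₄ : Fin m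

  edge : Quad → Fin m → Fin m → Bool
  edge (quad a b c d) x y =
    samePair x y a b ∨ samePair x y b c ∨ samePair x y c d ∨ samePair x y d a

  record Edge (T : Quad) (x y : Fin m) : Set where
    constructor ⟨_⟩
    field isEdge : edge T x y ≡ true
  open Edge public

  EdgeCases : Quad → Fin m → Fin m → Set
  EdgeCases (quad a b c d) x y =
    SamePair x y a b ⊎ SamePair x y b c ⊎ SamePair x y c d ⊎ SamePair x y d a

  Edge⇒EdgeCases : ∀ T {x y} → Edge T x y → EdgeCases T x y
  Edge⇒EdgeCases (quad a b c d) ⟨ h ⟩ with ∨-true h
  ... | inj₁ h₁ = inj₁ (samePair⇒SamePair h₁)
  ... | inj₂ h₂ with ∨-true h₂
  ... | inj₁ h₃ = inj₂ (inj₁ (samePair⇒SamePair h₃))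
  ... | inj₂ h₄ with ∨-true h₄
  ... | inj₁ h₅ = inj₂ (inj₂ (inj₁ (samePair⇒SamePair h₅)))
  ... | inj₂ h₆ = inj₂ (inj₂ (inj₂ (samePair⇒SamePair h₆)))

  EdgeCases⇒Edge : ∀ T {x y} → EdgeCases T x y → Edge T x y
  EdgeCases⇒Edge (quad a b c d) (inj₁ p) = ⟨ ∨-trueˡ _ (SamePair⇒samePair p) ⟩
  EdgeCases⇒Edge (quad a b c d) {x} {y} (inj₂ (inj₁ p)) =
    ⟨ ∨-trueʳ (samePair x y a b) (∨-trueˡ _ (SamePair⇒samePair p)) ⟩
  EdgeCases⇒Edge (quad a b c d) {x} {y} (inj₂ (inj₂ (inj₁ p))) =
    ⟨ ∨-trueʳ (samePair x y a b) (∨-trueʳ (samePair x y b c) (∨-trueˡ _ (SamePair⇒samePair p))) ⟩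
  EdgeCases⇒Edge (quad a b c d) {x} {y} (inj₂ (inj₂ (inj₂ p))) =
    ⟨ ∨-trueʳ (samePair x y a b) (∨-trueʳ (samePair x y b c)
        (∨-trueʳ (samePair x y c d) (SamePair⇒samePair p))) ⟩

  module _ (a b c d : Fin m) where
    ab∈ : Edge (quad a b c d) a b
    ab∈ = EdgeCases⇒Edge (quad a b c d) (inj₁ (inj₁ (refl , refl)))
    bc∈ : Edge (quad a b c d) b c
    bc∈ = EdgeCases⇒Edge (quad a b c d) (inj₂ (inj₁ (inj₁ (refl , refl))))
    cd∈ : Edge (quad a b c d) c d
    cd∈ = EdgeCases⇒Edge (quad a b c d) (inj₂ (inj₂ (inj₁ (inj₁ (refl , refl)))))
    da∈ : Edge (quad a b c d) d a
    da∈ = EdgeCases⇒Edge (quad a b c d) (inj₂ (inj₂ (inj₂ (inj₁ (refl , refl)))))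
    ba∈ : Edge (quad a b c d) b a
    ba∈ = EdgeCases⇒Edge (quad a b c d) (inj₁ (inj₂ (refl , refl)))
    cb∈ : Edge (quad a b c d) c b
    cb∈ = EdgeCases⇒Edge (quad a b c d) (inj₂ (inj₁ (inj₂ (refl , refl))))
    dc∈ : Edge (quad a b c d) d c
    dc∈ = EdgeCases⇒Edge (quad a b c d) (inj₂ (inj₂ (inj₁ (inj₂ (refl , refl)))))
    ad∈ : Edge (quad a b c d) a d
    ad∈ = EdgeCases⇒Edge (quad a b c d) (inj₂ (inj₂ (inj₂ (inj₂ (refl , refl)))))

  infix 4 _≈_

  _≈_ : Quad → Quad → Set
  T ≈ T′ = ∀ x y → edge T x y ≡ edge T′ x y

  ≈-sym : ∀ {T T′} → T ≈ T′ → T′ ≈ T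
  ≈-sym h x y = sym (h x y)

  ≈-trans : ∀ {T T′ T″} → T ≈ T′ → T′ ≈ T″ → T ≈ T″
  ≈-trans h k x y = trans (h x y) (k x y)

  ≈-Edge : ∀ {T T′} → T ≈ T′ → ∀ {x y} → Edge T x y → Edge T′ x y
  ≈-Edge h {x} {y} ⟨ e ⟩ = ⟨ trans (sym (h x y)) e ⟩

  EdgeCases⇔⇒≈ : ∀ T T′ → (∀ {x y} → EdgeCases T x y → EdgeCases T′ x y) →
            (∀ {x y} → EdgeCases T′ x y → EdgeCases T x y) → T ≈ T′
  EdgeCases⇔⇒≈ T T′ f g x y =
    bool-ext (λ h → isEdge (EdgeCases⇒Edge T′ {x} {y} (f (Edge⇒EdgeCases T ⟨ h ⟩))))
             (λ h → isEdge (EdgeCases⇒Edge T {x} {y} (g (Edge⇒EdgeCases T′ ⟨ h ⟩))))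

  Edge-sym : ∀ T {x y} → Edge T x y → Edge T y x
  Edge-sym (quad a b c d) e = EdgeCases⇒Edge _ (swap (Edge⇒EdgeCases _ e))
    where
    swap : ∀ {x y} → EdgeCases (quad a b c d) x y → EdgeCases (quad a b c d) y x
    swap (inj₁ p)               = inj₁ (SamePair-swapˡ p)
    swap (inj₂ (inj₁ p))        = inj₂ (inj₁ (SamePair-swapˡ p))
    swap (inj₂ (inj₂ (inj₁ p))) = inj₂ (inj₂ (inj₁ (SamePair-swapˡ p)))
    swap (inj₂ (inj₂ (inj₂ p))) = inj₂ (inj₂ (inj₂ (SamePair-swapˡ p)))

  ≈-fourth : ∀ {a b c t t′} → t ≡ t′ → quad a b c t ≈ quad a b c t′
  ≈-fourth refl _ _ = refl

  rotate : Quad → Quad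
  rotate (quad a b c d) = quad b c d a

  reverse : Quad → Quad
  reverse (quad a b c d) = quad d c b a

  ≈-rotate : ∀ T → T ≈ rotate T
  ≈-rotate (quad a b c d) = EdgeCases⇔⇒≈ _ _ f g
    where
    f : ∀ {x y} → EdgeCases (quad a b c d) x y → EdgeCases (quad b c d a) x y
    f (inj₁ p)               = inj₂ (inj₂ (inj₂ p))
    f (inj₂ (inj₁ p))        = inj₁ p
    f (inj₂ (inj₂ (inj₁ p))) = inj₂ (inj₁ p)
    f (inj₂ (inj₂ (inj₂ p))) = inj₂ (inj₂ (inj₁ p))
    g : ∀ {x y} → EdgeCases (quad b c d a) x y → EdgeCases (quad a b c d) x y
    g (inj₁ p)               = inj₂ (inj₁ p)
    g (inj₂ (inj₁ p))        = inj₂ (inj₂ (inj₁ p))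
    g (inj₂ (inj₂ (inj₁ p))) = inj₂ (inj₂ (inj₂ p))
    g (inj₂ (inj₂ (inj₂ p))) = inj₁ p

  ≈-reverse : ∀ T → T ≈ reverse T
  ≈-reverse (quad a b c d) = EdgeCases⇔⇒≈ _ _ f f
    where
    f : ∀ {a b c d x y} → EdgeCases (quad a b c d) x y → EdgeCases (quad d c b a) x y
    f (inj₁ p)               = inj₂ (inj₂ (inj₁ (SamePair-swapʳ p)))
    f (inj₂ (inj₁ p))        = inj₂ (inj₁ (SamePair-swapʳ p))
    f (inj₂ (inj₂ (inj₁ p))) = inj₁ (SamePair-swapʳ p)
    f (inj₂ (inj₂ (inj₂ p))) = inj₂ (inj₂ (inj₂ (SamePair-swapʳ p)))

  ≈-rotate² : ∀ T → T ≈ rotate (rotate T)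
  ≈-rotate² T = ≈-trans (≈-rotate T) (≈-rotate (rotate T))

  ≈-rotate³ : ∀ T → T ≈ rotate (rotate (rotate T))
  ≈-rotate³ T = ≈-trans (≈-rotate² T) (≈-rotate (rotate (rotate T)))

  Distinct : Quad → Set
  Distinct (quad a b c d) = Distinct4 a b c d

  Distinct-rotate : ∀ {T} → Distinct T → Distinct (rotate T)
  Distinct-rotate {quad a b c d} (ab , ac , ad , bc , bd , cd) =
    bc , bd , ≢-sym ab , cd , ≢-sym ac , ≢-sym ad

  Distinct-reverse : ∀ {T} → Distinct T → Distinct (reverse T)
  Distinct-reverse {quad a b c d} (ab , ac , ad , bc , bd , cd) =
    ≢-sym cd , ≢-sym bd , ≢-sym ad , ≢-sym bc , ≢-sym ac , ≢-sym ab

  Edge⇒hub-pair : ∀ {u y v t a b} → Edge (quad u y v t) a b →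
                  (samePair a b u y ≡ true ⊎ samePair a b v y ≡ true) ⊎
                  (samePair a b u t ≡ true ⊎ samePair a b v t ≡ true)
  Edge⇒hub-pair e with Edge⇒EdgeCases _ e
  ... | inj₁ p               = inj₁ (inj₁ (SamePair⇒samePair p))
  ... | inj₂ (inj₁ p)        = inj₁ (inj₂ (SamePair⇒samePair (SamePair-swapʳ p)))
  ... | inj₂ (inj₂ (inj₁ p)) = inj₂ (inj₂ (SamePair⇒samePair p))
  ... | inj₂ (inj₂ (inj₂ p)) = inj₂ (inj₁ (SamePair⇒samePair (SamePair-swapʳ p)))

  Edge⇒corner : ∀ {a b c d x y} → Edge (quad a b c d) x y → x ≡ a ⊎ x ≡ b ⊎ x ≡ c ⊎ x ≡ d
  Edge⇒corner e with Edge⇒EdgeCases _ e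
  ... | inj₁ (inj₁ (p , _))               = inj₁ p
  ... | inj₁ (inj₂ (p , _))               = inj₂ (inj₁ p)
  ... | inj₂ (inj₁ (inj₁ (p , _)))        = inj₂ (inj₁ p)
  ... | inj₂ (inj₁ (inj₂ (p , _)))        = inj₂ (inj₂ (inj₁ p))
  ... | inj₂ (inj₂ (inj₁ (inj₁ (p , _)))) = inj₂ (inj₂ (inj₁ p))
  ... | inj₂ (inj₂ (inj₁ (inj₂ (p , _)))) = inj₂ (inj₂ (inj₂ p))
  ... | inj₂ (inj₂ (inj₂ (inj₁ (p , _)))) = inj₂ (inj₂ (inj₂ p))
  ... | inj₂ (inj₂ (inj₂ (inj₂ (p , _)))) = inj₁ p

  neighbours₁ : ∀ {a b c d z} → Distinct (quad a b c d) → Edge (quad a b c d) a z → z ≡ b ⊎ z ≡ d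
  neighbours₁ (ab , ac , ad , _) e with Edge⇒EdgeCases _ e
  ... | inj₁ (inj₁ (_ , p))               = inj₁ p
  ... | inj₂ (inj₂ (inj₂ (inj₂ (_ , p)))) = inj₂ p
  ... | inj₁ (inj₂ (p , _))               = ⊥-elim (ab p)
  ... | inj₂ (inj₁ (inj₁ (p , _)))        = ⊥-elim (ab p)
  ... | inj₂ (inj₁ (inj₂ (p , _)))        = ⊥-elim (ac p)
  ... | inj₂ (inj₂ (inj₁ (inj₁ (p , _)))) = ⊥-elim (ac p)
  ... | inj₂ (inj₂ (inj₁ (inj₂ (p , _)))) = ⊥-elim (ad p)
  ... | inj₂ (inj₂ (inj₂ (inj₁ (p , _)))) = ⊥-elim (ad p)

  neighbours₂ : ∀ {a b c d z} → Distinct (quad a b c d) → Edge (quad a b c d) b z → z ≡ c ⊎ z ≡ a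
  neighbours₂ dist e = neighbours₁ (Distinct-rotate dist) (≈-Edge (≈-rotate _) e)

  neighbours₃ : ∀ {a b c d z} → Distinct (quad a b c d) → Edge (quad a b c d) c z → z ≡ d ⊎ z ≡ b
  neighbours₃ dist e = neighbours₁ (Distinct-rotate (Distinct-rotate dist)) (≈-Edge (≈-rotate² _) e)

  neighbours₄ : ∀ {a b c d z} → Distinct (quad a b c d) → Edge (quad a b c d) d z → z ≡ a ⊎ z ≡ c
  neighbours₄ dist e =
    neighbours₁ (Distinct-rotate (Distinct-rotate (Distinct-rotate dist))) (≈-Edge (≈-rotate³ _) e)

  startAt : ∀ T {x y} → Distinct T → Edge T x y →
            ∃[ z ] ∃[ w ] T ≈ quad x y z w × Distinct (quad x y z w)
  startAt T@(quad a b c d) dist e with Edge⇒EdgeCases T e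
  ... | inj₁ (inj₁ (refl , refl)) = c , d , (λ _ _ → refl) , dist
  ... | inj₁ (inj₂ (refl , refl)) =
    d , c , ≈-trans (≈-reverse T) (≈-rotate² (reverse T)) , Distinct-rotate (Distinct-rotate (Distinct-reverse dist))
  ... | inj₂ (inj₁ (inj₁ (refl , refl))) = d , a , ≈-rotate T , Distinct-rotate dist
  ... | inj₂ (inj₁ (inj₂ (refl , refl))) =
    a , d , ≈-trans (≈-reverse T) (≈-rotate (reverse T)) , Distinct-rotate (Distinct-reverse dist)
  ... | inj₂ (inj₂ (inj₁ (inj₁ (refl , refl)))) =
    a , b , ≈-rotate² T , Distinct-rotate (Distinct-rotate dist)
  ... | inj₂ (inj₂ (inj₁ (inj₂ (refl , refl)))) = b , a , ≈-reverse T , Distinct-reverse dist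
  ... | inj₂ (inj₂ (inj₂ (inj₁ (refl , refl)))) =
    b , c , ≈-rotate³ T , Distinct-rotate (Distinct-rotate (Distinct-rotate dist))
  ... | inj₂ (inj₂ (inj₂ (inj₂ (refl , refl)))) =
    c , b , ≈-trans (≈-reverse T) (≈-rotate³ (reverse T)) ,
    Distinct-rotate (Distinct-rotate (Distinct-rotate (Distinct-reverse dist)))

  startAt-path : ∀ T {u y v} → Distinct T → Edge T u y → Edge T y v → u ≢ v →
                 ∃[ t ] T ≈ quad u y v t × Distinct (quad u y v t)
  startAt-path T dist uy yv u≢v with startAt T dist uy
  ... | z , w , T≈ , dist′ with neighbours₂ dist′ (≈-Edge T≈ yv)
  ... | inj₁ refl = w , T≈ , dist′
  ... | inj₂ v≡u  = ⊥-elim (u≢v (sym v≡u))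

  ≈-path : ∀ T {x y z w} → Distinct T → Edge T x y → Edge T y z → Edge T z w →
           x ≢ z → y ≢ w → T ≈ quad x y z w
  ≈-path T dist xy yz zw x≢z y≢w with startAt-path T dist xy yz x≢z
  ... | t , T≈ , dist′ with neighbours₃ dist′ (≈-Edge T≈ zw)
  ... | inj₁ refl = T≈
  ... | inj₂ w≡y  = ⊥-elim (y≢w (sym w≡y))

  Alternating : Graph m → Quad → Set
  Alternating G (quad a b c d) = Alt4 G a b c d

  Alternating⇒Distinct : ∀ {G T} → Alternating G T → Distinct T
  Alternating⇒Distinct {T = quad a b c d} = proj₁

  adj-differs-at : ∀ (G : Graph m) {T x p q} → (∀ {z} → Edge T x z → z ≡ p ⊎ z ≡ q) →
                   adj G x p ≡ true → adj G x q ≡ false →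
                   ∀ {y z} → Edge T x y → Edge T x z → y ≢ z → adj G x y ≢ adj G x z
  adj-differs-at G nb xp xq xy xz y≢z eq with nb xy | nb xz
  ... | inj₁ refl | inj₁ refl = y≢z refl
  ... | inj₁ refl | inj₂ refl = false≢true (trans (sym xq) (trans (sym eq) xp))
  ... | inj₂ refl | inj₁ refl = false≢true (trans (sym xq) (trans eq xp))
  ... | inj₂ refl | inj₂ refl = y≢z refl

  alternating-sides : ∀ (G : Graph m) {T x y z} → Alternating G T → Edge T x y → Edge T x z → y ≢ z →
                      adj G x y ≢ adj G x z
  alternating-sides G {quad a b c d} (dist , ab , cd , ad , bc) xy xz with Edge⇒corner xy
  ... | inj₁ refl =
    adj-differs-at G (neighbours₁ dist) ab ad xy xz
  ... | inj₂ (inj₁ refl) =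
    adj-differs-at G ([ inj₂ , inj₁ ] ∘ neighbours₂ dist) (trans (Graph.sym G b a) ab) bc xy xz
  ... | inj₂ (inj₂ (inj₁ refl)) =
    adj-differs-at G (neighbours₃ dist) cd (trans (Graph.sym G c b) bc) xy xz
  ... | inj₂ (inj₂ (inj₂ refl)) =
    adj-differs-at G ([ inj₂ , inj₁ ] ∘ neighbours₄ dist) (trans (Graph.sym G d c) cd)
      (trans (Graph.sym G d a) ad) xy xz

  module _ (G : Graph m) {T x y z} (al : Alternating G T) (xy : Edge T x y) (xz : Edge T x z)
           (y≢z : y ≢ z) where
    alternating-not : ∀ {β} → adj G x y ≡ β → adj G x z ≡ not β
    alternating-not e = trans (¬-not (≢-sym (alternating-sides G al xy xz y≢z))) (cong not e)

    alternating-¬same : ∀ {β} → adj G x y ≡ β → adj G x z ≡ β → ⊥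
    alternating-¬same e₁ e₂ = alternating-sides G al xy xz y≢z (trans e₁ (sym e₂))

  switchAdj-xor : ∀ s₁ s₂ s₃ s₄ h →
    (s₁ ≡ true → h ≡ true) → (s₂ ≡ true → h ≡ false) →
    (s₃ ≡ true → h ≡ true) → (s₄ ≡ true → h ≡ false) →
    (if s₁ ∨ s₃ then false else if s₄ ∨ s₂ then true else h) ≡ h xor (s₁ ∨ s₂ ∨ s₃ ∨ s₄)
  switchAdj-xor true  _     _     _     _ p _ _ _ rewrite p refl = refl
  switchAdj-xor false true  true  _     _ _ q p _ = ⊥-elim (false≢true (trans (sym (q refl)) (p refl)))
  switchAdj-xor false false true  _     _ _ _ p _ rewrite p refl = refl
  switchAdj-xor false s₂    false true  _ _ _ _ p rewrite p refl | ∨-zeroʳ s₂ = refl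
  switchAdj-xor false true  false false _ _ q _ _ rewrite q refl = refl
  switchAdj-xor false false false false h _ _ _ _ = sym (xor-identityʳ h)

  switch-xor : ∀ {H H′ : Graph m} {u v w x} → SwitchTo H H′ u v w x →
               ∀ a b → adj H′ a b ≡ adj H a b xor edge (quad u v w x) a b
  switch-xor {H} {u = u} {v} {w} {x} ((_ , uv , wx , ux , vw) , H′≡) a b = begin
    _ ≡⟨ H′≡ a b ⟩
    switchAdj H u v w x a b
      ≡⟨ switchAdj-xor (samePair a b u v) (samePair a b v w) (samePair a b w x) (samePair a b u x)
                       (adj H a b) (removed uv) (removed vw) (removed wx) (removed ux) ⟩
    adj H a b xor (samePair a b u v ∨ samePair a b v w ∨ samePair a b w x ∨ samePair a b u x)
      ≡⟨ cong (λ s → adj H a b xor (samePair a b u v ∨ samePair a b v w ∨ samePair a b w x ∨ s))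
              (samePair-swapʳ a b u x) ⟩
    adj H a b xor edge (quad u v w x) a b ∎
    where
    open ≡-Reasoning
    removed : ∀ {p q β} → adj H p q ≡ β → samePair a b p q ≡ true → adj H a b ≡ β
    removed pq s = trans (adj-SamePair H (samePair⇒SamePair s)) pq

  record SwitchedAlong (G₀ : Graph m) (T : Quad) (G : Graph m) : Set where
    field
      alternating : Alternating G₀ T
      adj-xor     : ∀ x y → adj G x y ≡ adj G₀ x y xor edge T x y
  open SwitchedAlong public

  SwitchTo⇒SwitchedAlong : ∀ {G₀ G : Graph m} {a b c d} → SwitchTo G₀ G a b c d →
                           SwitchedAlong G₀ (quad a b c d) G
  SwitchTo⇒SwitchedAlong {G₀} {G} s = record { alternating = proj₁ s ; adj-xor = switch-xor {G₀} {G} s }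

  SwitchedAlong-≈ : ∀ {G₀ G : Graph m} {T T′} → SwitchedAlong G₀ T G → T ≈ T′ → Alternating G₀ T′ →
                    SwitchedAlong G₀ T′ G
  SwitchedAlong-≈ {G₀} s T≈T′ al = record
    { alternating = al
    ; adj-xor     = λ x y → trans (adj-xor s x y) (cong (adj G₀ x y xor_) (T≈T′ x y)) }

  SwitchedAlong-≈⇒SameGraph : ∀ {G₀ G G′ : Graph m} {T T′} →
                              SwitchedAlong G₀ T G → SwitchedAlong G₀ T′ G′ →
                              T ≈ T′ → SameGraph G G′
  SwitchedAlong-≈⇒SameGraph {G₀} s s′ T≈T′ x y =
    trans (adj-xor s x y) (trans (cong (adj G₀ x y xor_) (T≈T′ x y)) (sym (adj-xor s′ x y)))

  infix 4 _≈_⊕_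

  _≈_⊕_ : Quad → Quad → Quad → Set
  T′ ≈ T ⊕ S = ∀ x y → edge T′ x y ≡ edge T x y xor edge S x y

  SwitchedAlong-compose : ∀ {G₀ G G′ : Graph m} {T T′ a b c d} →
                          SwitchedAlong G₀ T G → SwitchedAlong G₀ T′ G′ →
                          SwitchTo G G′ a b c d → T′ ≈ T ⊕ quad a b c d
  SwitchedAlong-compose {G₀} {G} {G′} {T} {T′} {a} {b} {c} {d} s s′ sw x y =
    xor-cancelˡ (adj G₀ x y) _ _ (begin
      adj G₀ x y xor edge T′ x y                 ≡⟨ sym (adj-xor s′ x y) ⟩
      adj G′ x y                                 ≡⟨ switch-xor {G} {G′} sw x y ⟩
      adj G x y xor edge S x y                   ≡⟨ cong (_xor edge S x y) (adj-xor s x y) ⟩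
      (adj G₀ x y xor edge T x y) xor edge S x y ≡⟨ xor-assoc (adj G₀ x y) _ _ ⟩
      adj G₀ x y xor (edge T x y xor edge S x y) ∎)
    where
    open ≡-Reasoning
    S = quad a b c d

  record SwitchApart (T T′ : Quad) : Set where
    field
      {difference} : Quad
      difference-distinct : Distinct difference
      ≈⊕difference        : T′ ≈ T ⊕ difference
      ≉                   : ¬ T ≈ T′
  open SwitchApart public

  edge? : ∀ T x y → Edge T x y ⊎ edge T x y ≡ false
  edge? T x y with edge T x y in eq
  ... | true  = inj₁ ⟨ eq ⟩
  ... | false = inj₂ refl

  ¬Edge⇒false : ∀ {T x y} → ¬ Edge T x y → edge T x y ≡ false
  ¬Edge⇒false {T} {x} {y} ¬e with edge? T x y
  ... | inj₁ e = ⊥-elim (¬e e)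
  ... | inj₂ f = f

  ⊕-Edge : ∀ {T T′ S} → T′ ≈ T ⊕ S → ∀ {x y} → Edge T x y → edge T′ x y ≡ false → Edge S x y
  ⊕-Edge {T} {T′} {S} T′≈ {x} {y} ⟨ e ⟩ e′ with edge? S x y
  ... | inj₁ s = s
  ... | inj₂ s = ⊥-elim (false≢true (begin
    false                     ≡⟨ sym e′ ⟩
    edge T′ x y               ≡⟨ T′≈ x y ⟩
    edge T x y xor edge S x y ≡⟨ cong₂ _xor_ e s ⟩
    true                      ∎))
    where open ≡-Reasoning

  ⊕-self : ∀ {T S} T′ → T′ ≈ T ⊕ S → S ≈ T → ⊥
  ⊕-self {T} {S} T′@(quad a b _ _) T′≈ S≈T = false≢true (begin
    false                       ≡⟨ sym (xor-same (edge T a b)) ⟩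
    edge T a b xor edge T a b   ≡⟨ cong (edge T a b xor_) (sym (S≈T a b)) ⟩
    edge T a b xor edge S a b   ≡⟨ sym (T′≈ a b) ⟩
    edge T′ a b                 ≡⟨ isEdge (ab∈ a b _ _) ⟩
    true                        ∎)
    where open ≡-Reasoning

  cross : Quad → Quad
  cross (quad a b c d) = quad a b d c

  SharePath : Quad → Quad → Set
  SharePath (quad a b c d) T′ =
    (Edge T′ a b × Edge T′ b c) ⊎ (Edge T′ b a × Edge T′ a d) ⊎
    (Edge T′ c d × Edge T′ d a) ⊎ (Edge T′ d c × Edge T′ c b)

  consecutive-sides-missing-⊥ : ∀ {T T′} → SwitchApart T T′ → ∀ {p q r s} → Distinct (quad p q r s) →
                                T ≈ quad p q r s → edge T′ p q ≡ false → edge T′ q r ≡ false →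
                                edge T′ r s ≡ false → ⊥
  consecutive-sides-missing-⊥ {T} {T′} apart {p} {q} {r} {s} (_ , p≢r , _ , _ , q≢s , _) T≈ pq qr rs =
    ⊕-self T′ (≈⊕difference apart)
      (≈-trans (≈-path S (difference-distinct apart) (missing (ab∈ p q r s) pq) (missing (bc∈ p q r s) qr)
                       (missing (cd∈ p q r s) rs) p≢r q≢s)
               (≈-sym T≈))
    where
    S = difference apart
    missing : ∀ {x y} → Edge (quad p q r s) x y → edge T′ x y ≡ false → Edge S x y
    missing e = ⊕-Edge (≈⊕difference apart) (≈-Edge (≈-sym T≈) e)

  opposite-sides : ∀ {a b c d} T′ → Distinct (quad a b c d) → Distinct T′ → Edge T′ a b → Edge T′ c d →
                   ¬ quad a b c d ≈ T′ → T′ ≈ quad a b d c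
  opposite-sides {a} {b} {c} {d} T′ (_ , a≢c , a≢d , b≢c , b≢d , _) distT′ ab cd T≉T′
    with startAt T′ distT′ ab
  ... | z , w , T′≈ , _ with Edge⇒EdgeCases (quad a b z w) (≈-Edge T′≈ cd)
  ... | inj₁ (inj₁ (c≡a , _))               = ⊥-elim (a≢c (sym c≡a))
  ... | inj₁ (inj₂ (c≡b , _))               = ⊥-elim (b≢c (sym c≡b))
  ... | inj₂ (inj₁ (inj₁ (c≡b , _)))        = ⊥-elim (b≢c (sym c≡b))
  ... | inj₂ (inj₁ (inj₂ (_ , d≡b)))        = ⊥-elim (b≢d (sym d≡b))
  ... | inj₂ (inj₂ (inj₁ (inj₁ (refl , refl)))) = ⊥-elim (T≉T′ (≈-sym T′≈))
  ... | inj₂ (inj₂ (inj₁ (inj₂ (refl , refl)))) = T′≈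
  ... | inj₂ (inj₂ (inj₂ (inj₁ (_ , d≡a))))   = ⊥-elim (a≢d (sym d≡a))
  ... | inj₂ (inj₂ (inj₂ (inj₂ (c≡a , _))))   = ⊥-elim (a≢c (sym c≡a))

  -- T and T′ differ by a quadrangle, so they share exactly two sides: adjacent ones or opposite ones.
  SwitchApart-cases : ∀ {T T′} → Distinct T → Distinct T′ → SwitchApart T T′ →
                      SharePath T T′ ⊎ T′ ≈ cross T ⊎ T′ ≈ cross (rotate T)
  SwitchApart-cases {T@(quad a b c d)} {T′} distT distT′ apart
    with edge? T′ a b | edge? T′ b c | edge? T′ c d | edge? T′ d a
  ... | inj₁ ab | inj₁ bc | _       | _       = inj₁ (inj₁ (ab , bc))
  ... | _       | inj₁ bc | inj₁ cd | _       = inj₁ (inj₂ (inj₂ (inj₂ (Edge-sym T′ cd , Edge-sym T′ bc))))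
  ... | _       | _       | inj₁ cd | inj₁ da = inj₁ (inj₂ (inj₂ (inj₁ (cd , da))))
  ... | inj₁ ab | _       | _       | inj₁ da = inj₁ (inj₂ (inj₁ (Edge-sym T′ ab , Edge-sym T′ da)))
  ... | inj₂ ab | inj₂ bc | inj₂ cd | _       =
    ⊥-elim (consecutive-sides-missing-⊥ apart distT (λ _ _ → refl) ab bc cd)
  ... | inj₁ _  | inj₂ bc | inj₂ cd | inj₂ da =
    ⊥-elim (consecutive-sides-missing-⊥ apart (Distinct-rotate distT) (≈-rotate T) bc cd da)
  ... | inj₂ ab | inj₁ _  | inj₂ cd | inj₂ da =
    ⊥-elim (consecutive-sides-missing-⊥ apart (Distinct-rotate (Distinct-rotate distT)) (≈-rotate² T) cd da ab)
  ... | inj₂ ab | inj₂ bc | inj₁ _  | inj₂ da =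
    ⊥-elim (consecutive-sides-missing-⊥ apart (Distinct-rotate (Distinct-rotate (Distinct-rotate distT)))
                                         (≈-rotate³ T) da ab bc)
  ... | inj₁ ab | inj₂ _  | inj₁ cd | inj₂ _  =
    inj₂ (inj₁ (opposite-sides T′ distT distT′ ab cd (≉ apart)))
  ... | inj₂ _  | inj₁ bc | inj₂ _  | inj₁ da =
    inj₂ (inj₂ (opposite-sides T′ (Distinct-rotate distT) distT′ bc da (≉ apart ∘ ≈-trans (≈-rotate T))))

  SwitchApart-≈ˡ : ∀ {T₁ T₂ T′} → T₁ ≈ T₂ → SwitchApart T₁ T′ → SwitchApart T₂ T′
  SwitchApart-≈ˡ T₁≈T₂ apart = record
    { difference-distinct = difference-distinct apart
    ; ≈⊕difference        = λ x y → trans (≈⊕difference apart x y)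
                                          (cong (_xor edge (difference apart) x y) (T₁≈T₂ x y))
    ; ≉                   = ≉ apart ∘ ≈-trans T₁≈T₂ }

  SharePath-middle : ∀ {a b c d T′} → SharePath (quad a b c d) T′ → Edge T′ b c ⊎ Edge T′ d a
  SharePath-middle {T′ = T′} (inj₁ (_ , bc))               = inj₁ bc
  SharePath-middle {T′ = T′} (inj₂ (inj₁ (_ , ad)))        = inj₂ (Edge-sym T′ ad)
  SharePath-middle {T′ = T′} (inj₂ (inj₂ (inj₁ (_ , da)))) = inj₂ da
  SharePath-middle {T′ = T′} (inj₂ (inj₂ (inj₂ (_ , cb)))) = inj₁ (Edge-sym T′ cb)

  -- Alternation with the two colours as a parameter, so that rotate T is covered too.
  Coloured : Graph m → Bool → Quad → Set
  Coloured G β (quad a b c d) =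
    adj G a b ≡ β × adj G c d ≡ β × adj G b c ≡ not β × adj G d a ≡ not β

  Alternating⇒Coloured : ∀ {G T} → Alternating G T → Coloured G true T
  Alternating⇒Coloured {G} {quad a b c d} (_ , ab , cd , ad , bc) = ab , cd , bc , trans (Graph.sym G d a) ad

  Alternating⇒Coloured-rotate : ∀ {G T} → Alternating G T → Coloured G false (rotate T)
  Alternating⇒Coloured-rotate {G} {quad a b c d} (_ , ab , cd , ad , bc) = bc , trans (Graph.sym G d a) ad , cd , ab

  -- If Tⱼ uses the diagonals of T, a third alternating quadrangle apart from both T and Tⱼ
  -- would meet some corner in two sides of the same adjacency.
  crossed-⊥ : ∀ (G : Graph m) β {a b c d Tⱼ Tₖ} → Distinct (quad a b c d) → Coloured G β (quad a b c d) →
              Alternating G Tⱼ → Alternating G Tₖ → Tⱼ ≈ quad a b d c →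
              SwitchApart (quad a b c d) Tₖ → SwitchApart Tⱼ Tₖ → ⊥
  crossed-⊥ G β {a} {b} {c} {d} {Tⱼ} {Tₖ} dist@(a≢b , a≢c , a≢d , b≢c , b≢d , c≢d) (ab , cd , bc , da)
            alⱼ alₖ Tⱼ≈ ik jk =
    cases (SwitchApart-cases dist (Alternating⇒Distinct {G} alₖ) ik)
          (SwitchApart-cases dist′ (Alternating⇒Distinct {G} alₖ) (SwitchApart-≈ˡ Tⱼ≈ jk))
    where
    dist′ : Distinct (quad a b d c)
    dist′ = a≢b , a≢d , a≢c , b≢d , b≢c , ≢-sym c≢d

    inTⱼ : ∀ {x y} → Edge (quad a b d c) x y → Edge Tⱼ x y
    inTⱼ = ≈-Edge (≈-sym Tⱼ≈)

    bd : adj G b d ≡ not β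
    bd = alternating-not G alⱼ (inTⱼ (ba∈ a b d c)) (inTⱼ (bc∈ a b d c)) a≢d (trans (Graph.sym G b a) ab)

    ca : adj G c a ≡ not β
    ca = alternating-not G alⱼ (inTⱼ (dc∈ a b d c)) (inTⱼ (da∈ a b d c)) (≢-sym a≢d) cd

    cb : adj G c b ≡ not β
    cb = trans (Graph.sym G c b) bc

    same : ∀ x {y z} → Edge Tₖ x y → Edge Tₖ x z → y ≢ z →
           adj G x y ≡ not β → adj G x z ≡ not β → ⊥
    same x xy xz y≢z = alternating-¬same G alₖ xy xz y≢z

    middles : Edge Tₖ b c ⊎ Edge Tₖ d a → Edge Tₖ b d ⊎ Edge Tₖ c a → ⊥
    middles (inj₁ kbc) (inj₁ kbd) = same b kbc kbd c≢d bc bd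
    middles (inj₁ kbc) (inj₂ kca) = same c (Edge-sym Tₖ kbc) kca (≢-sym a≢b) cb ca
    middles (inj₂ kda) (inj₁ kbd) = same d kda (Edge-sym Tₖ kbd) a≢b da (trans (Graph.sym G d b) bd)
    middles (inj₂ kda) (inj₂ kca) = same a (Edge-sym Tₖ kda) (Edge-sym Tₖ kca) (≢-sym c≢d)
                                         (trans (Graph.sym G a d) da) (trans (Graph.sym G a c) ca)

    cases : SharePath (quad a b c d) Tₖ ⊎ Tₖ ≈ quad a b d c ⊎ Tₖ ≈ quad b c a d →
            SharePath (quad a b d c) Tₖ ⊎ Tₖ ≈ quad a b c d ⊎ Tₖ ≈ quad b d a c → ⊥
    cases (inj₂ (inj₁ Tₖ≈)) _ = ≉ jk (≈-trans Tⱼ≈ (≈-sym Tₖ≈))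
    cases (inj₂ (inj₂ Tₖ≈)) _ =
      same c (≈-Edge (≈-sym Tₖ≈) (ba∈ b c a d)) (≈-Edge (≈-sym Tₖ≈) (bc∈ b c a d)) (≢-sym a≢b) cb ca
    cases (inj₁ _) (inj₂ (inj₁ Tₖ≈)) = ≉ ik (≈-sym Tₖ≈)
    cases (inj₁ _) (inj₂ (inj₂ Tₖ≈)) =
      same b (≈-Edge (≈-sym Tₖ≈) (ab∈ b d a c)) (≈-Edge (≈-sym Tₖ≈) (ad∈ b d a c)) (≢-sym c≢d) bd bc
    cases (inj₁ p₁) (inj₁ p₂) = middles (SharePath-middle p₁) (SharePath-middle p₂)

  triangle-SharePath : ∀ (G : Graph m) {Tᵢ Tⱼ Tₖ} →
                       Alternating G Tᵢ → Alternating G Tⱼ → Alternating G Tₖ →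
                       SwitchApart Tᵢ Tⱼ → SwitchApart Tᵢ Tₖ → SwitchApart Tⱼ Tₖ → SharePath Tᵢ Tⱼ
  triangle-SharePath G {Tᵢ} alᵢ alⱼ alₖ ij ik jk
    with SwitchApart-cases (Alternating⇒Distinct {G} alᵢ) (Alternating⇒Distinct {G} alⱼ) ij
  ... | inj₁ p = p
  ... | inj₂ (inj₁ Tⱼ≈) =
    ⊥-elim (crossed-⊥ G true (Alternating⇒Distinct {G} alᵢ) (Alternating⇒Coloured {G} alᵢ) alⱼ alₖ Tⱼ≈ ik jk)
  ... | inj₂ (inj₂ Tⱼ≈) =
    ⊥-elim (crossed-⊥ G false (Distinct-rotate (Alternating⇒Distinct {G} alᵢ)) (Alternating⇒Coloured-rotate {G} alᵢ)
                      alⱼ alₖ Tⱼ≈ (SwitchApart-≈ˡ (≈-rotate Tᵢ) ik) jk)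

  SwitchedAlong-apart : ∀ {G₀ G G′ : Graph m} {T T′} → SwitchedAlong G₀ T G → SwitchedAlong G₀ T′ G′ →
                        ¬ SameGraph G G′ → TwoSwitchAdjacent G G′ → SwitchApart T T′
  SwitchedAlong-apart s s′ G≠G′ (_ , _ , _ , _ , sw) = record
    { difference-distinct = proj₁ (proj₁ sw)
    ; ≈⊕difference        = SwitchedAlong-compose s s′ sw
    ; ≉                   = G≠G′ ∘ SwitchedAlong-≈⇒SameGraph s s′ }

  Through : Quad → Fin m → Fin m → Fin m → Set
  Through T u y v = Edge T u y × Edge T y v

  Alternating-≈ : ∀ (G : Graph m) {T u y v t} → Alternating G T → T ≈ quad u y v t → Distinct (quad u y v t) →
                  adj G u y ≡ true → Alternating G (quad u y v t)
  Alternating-≈ G {T} {u} {y} {v} {t} al T≈ dist@(_ , u≢v , _ , _ , y≢t , _) uy = dist , uy , vt , ut , yv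
    where
    side : ∀ {x z} → Edge (quad u y v t) x z → Edge T x z
    side = ≈-Edge (≈-sym T≈)
    yv : adj G y v ≡ false
    yv = alternating-not G al (side (ba∈ u y v t)) (side (bc∈ u y v t)) u≢v (trans (Graph.sym G y u) uy)
    vt : adj G v t ≡ true
    vt = alternating-not G al (side (cb∈ u y v t)) (side (cd∈ u y v t)) y≢t (trans (Graph.sym G v y) yv)
    ut : adj G u t ≡ false
    ut = alternating-not G al (side (ab∈ u y v t)) (side (ad∈ u y v t)) y≢t uy

  record OnPath (G : Graph m) (T : Quad) (u y v : Fin m) : Set where
    field
      fourth           : Fin m
      ≈quad            : T ≈ quad u y v fourth
      quad-alternating : Alternating G (quad u y v fourth)

  Through⇒OnPath : ∀ (G : Graph m) {T u y v} → Alternating G T → Through T u y v → u ≢ v →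
                   adj G u y ≡ true →
                   OnPath G T u y v
  Through⇒OnPath G {T} al (uy , yv) u≢v adj-uy with startAt-path T (Alternating⇒Distinct {G} al) uy yv u≢v
  ... | t , T≈ , dist = record { ≈quad = T≈ ; quad-alternating = Alternating-≈ G al T≈ dist adj-uy }

  record Hinge (G : Graph m) (T T′ : Quad) : Set where
    field
      u y v    : Fin m
      through  : Through T u y v
      through′ : Through T′ u y v
      u≢v      : u ≢ v
      uy       : adj G u y ≡ true

  SharePath⇒Hinge : ∀ (G : Graph m) {T T′} → Alternating G T → SharePath T T′ → Hinge G T T′
  SharePath⇒Hinge G {quad a b c d} ((_ , a≢c , _ , _ , b≢d , _) , ab , cd , _ , _) p with p
  ... | inj₁ q = record
    { through = ab∈ a b c d , bc∈ a b c d ; through′ = q ; u≢v = a≢c ; uy = ab }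
  ... | inj₂ (inj₁ q) = record
    { through = ba∈ a b c d , ad∈ a b c d ; through′ = q ; u≢v = b≢d ; uy = trans (Graph.sym G b a) ab }
  ... | inj₂ (inj₂ (inj₁ q)) = record
    { through = cd∈ a b c d , da∈ a b c d ; through′ = q ; u≢v = ≢-sym a≢c ; uy = cd }
  ... | inj₂ (inj₂ (inj₂ q)) = record
    { through = dc∈ a b c d , cb∈ a b c d ; through′ = q ; u≢v = ≢-sym b≢d ; uy = trans (Graph.sym G d c) cd }

  -- Otherwise u or v would meet both t₁ and t₂ in T, with equal adjacency.
  SharePath²⇒Through : ∀ (G : Graph m) {u y v t₁ t₂ T} →
                       Alternating G (quad u y v t₁) → Alternating G (quad u y v t₂) → Alternating G T → t₁ ≢ t₂ →
                       SharePath (quad u y v t₁) T → SharePath (quad u y v t₂) T → Through T u y v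
  SharePath²⇒Through G {u} {y} {v} {t₁} {t₂} {T} (_ , _ , vt₁ , ut₁ , _) (_ , _ , vt₂ , ut₂ , _) al t₁≢t₂ =
    go
    where
    at-u : Edge T u t₁ → Edge T u t₂ → ⊥
    at-u e₁ e₂ = alternating-¬same G al e₁ e₂ t₁≢t₂ ut₁ ut₂
    at-v : Edge T v t₁ → Edge T v t₂ → ⊥
    at-v e₁ e₂ = alternating-¬same G al e₁ e₂ t₁≢t₂ vt₁ vt₂
    go : SharePath (quad u y v t₁) T → SharePath (quad u y v t₂) T → Through T u y v
    go (inj₁ p) _ = p
    go _ (inj₁ p) = p
    go (inj₂ (inj₁ (yu , _))) (inj₂ (inj₂ (inj₂ (_ , vy)))) = Edge-sym T yu , Edge-sym T vy
    go (inj₂ (inj₂ (inj₂ (_ , vy)))) (inj₂ (inj₁ (yu , _))) = Edge-sym T yu , Edge-sym T vy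
    go (inj₂ (inj₁ (_ , k))) (inj₂ (inj₁ (_ , j))) = ⊥-elim (at-u k j)
    go (inj₂ (inj₁ (_ , k))) (inj₂ (inj₂ (inj₁ (_ , j)))) = ⊥-elim (at-u k (Edge-sym T j))
    go (inj₂ (inj₂ (inj₁ (_ , k)))) (inj₂ (inj₁ (_ , j))) = ⊥-elim (at-u (Edge-sym T k) j)
    go (inj₂ (inj₂ (inj₁ (_ , k)))) (inj₂ (inj₂ (inj₁ (_ , j)))) = ⊥-elim (at-u (Edge-sym T k) (Edge-sym T j))
    go (inj₂ (inj₂ (inj₁ (k , _)))) (inj₂ (inj₂ (inj₂ (j , _)))) = ⊥-elim (at-v k (Edge-sym T j))
    go (inj₂ (inj₂ (inj₂ (k , _)))) (inj₂ (inj₂ (inj₁ (j , _)))) = ⊥-elim (at-v (Edge-sym T k) j)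
    go (inj₂ (inj₂ (inj₂ (k , _)))) (inj₂ (inj₂ (inj₂ (j , _)))) = ⊥-elim (at-v (Edge-sym T k) (Edge-sym T j))

  record Fan (G : Graph m) {K} (T : Fin K → Quad) : Set where
    field
      u y v  : Fin m
      onPath : ∀ l → OnPath G (T l) u y v

  -- Two of the quadrangles share a path u y v; every other one shares a path with both of them
  -- and therefore passes through u y v as well.
  fan : ∀ (G : Graph m) {k} (T : Fin (3 + k) → Quad) → (∀ l → Alternating G (T l)) →
        (∀ l l′ → l ≢ l′ → SwitchApart (T l) (T l′)) → Fan G T
  fan G T al apart = record { u = u ; y = y ; v = v ; onPath = λ l → onPath (through-all l) }
    where
    open Hinge (SharePath⇒Hinge G (al zero)
      (triangle-SharePath G (al zero) (al (suc zero)) (al (suc (suc zero)))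
        (apart zero (suc zero) (λ ())) (apart zero (suc (suc zero)) (λ ()))
        (apart (suc zero) (suc (suc zero)) (λ ()))))
    open OnPath

    onPath : ∀ {l} → Through (T l) u y v → OnPath G (T l) u y v
    onPath th = Through⇒OnPath G (al _) th u≢v uy

    N₀ : OnPath G (T zero) u y v
    N₀ = onPath through
    N₁ : OnPath G (T (suc zero)) u y v
    N₁ = onPath through′

    apart-from : ∀ {l} (N : OnPath G (T l) u y v) l′ → l ≢ l′ → SwitchApart (quad u y v (fourth N)) (T l′)
    apart-from {l} N l′ l≢l′ = SwitchApart-≈ˡ (≈quad N) (apart l l′ l≢l′)

    t₀≢t₁ : fourth N₀ ≢ fourth N₁
    t₀≢t₁ eq = ≉ (apart zero (suc zero) (λ ()))
      (≈-trans (≈quad N₀) (≈-trans (≈-fourth {u} {y} {v} eq) (≈-sym (≈quad N₁))))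

    through-all : ∀ l → Through (T l) u y v
    through-all zero            = through
    through-all (suc zero)      = through′
    through-all l@(suc (suc _)) =
      SharePath²⇒Through G (quad-alternating N₀) (quad-alternating N₁) (al l) t₀≢t₁
        (triangle-SharePath G (quad-alternating N₀) (al l) (al (suc zero))
           (apart-from N₀ l (λ ())) (apart-from N₀ (suc zero) (λ ())) (apart l (suc zero) (λ ())))
        (triangle-SharePath G (quad-alternating N₁) (al l) (al zero)
           (apart-from N₁ l (λ ())) (apart-from N₁ zero (λ ())) (apart l zero (λ ())))

  switchQuad : ∀ {G G′ : Graph m} → TwoSwitchAdjacent G G′ → Quad
  switchQuad (a , b , c , d , _) = quad a b c d

  switchQuad-along : ∀ {G G′ : Graph m} (s : TwoSwitchAdjacent G G′) →
                     SwitchedAlong G (switchQuad {G} {G′} s) G′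
  switchQuad-along {G} {G′} (_ , _ , _ , _ , sw) = SwitchTo⇒SwitchedAlong {G} {G′} sw

module _ {m n : ℕ} (R : Fin n → Graph m) where

  InP-sym : ∀ {a b} → InP R a b → InP R b a
  InP-sym {a} {b} ((i , ab) , (j , ¬ab)) = (i , trans (Graph.sym (R i) b a) ab) , (j , trans (Graph.sym (R j) b a) ¬ab)

  InP-SamePair : ∀ {a b p q} → InP R p q → SamePair a b p q → InP R a b
  InP-SamePair pq (inj₁ (refl , refl)) = pq
  InP-SamePair pq (inj₂ (refl , refl)) = InP-sym pq

  TwoSwitchAdjacent⇒SwitchInDial : ∀ {i j} → TwoSwitchAdjacent (R i) (R j) → SwitchInDial R i j
  TwoSwitchAdjacent⇒SwitchInDial {i} {j} (a , b , c , d , sw@((_ , ab , cd , ad , bc) , _)) =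
    a , b , c , d , (b , P-ab) , (c , P-bc) , (d , P-cd) , (a , InP-sym P-ad) ,
    P-ab , P-cd , P-ad , P-bc , sw
    where
    after : ∀ {x z} → Edge (quad a b c d) x z → adj (R j) x z ≡ not (adj (R i) x z)
    after {x} {z} e = begin
      adj (R j) x z                         ≡⟨ switch-xor {H = R i} {H′ = R j} sw x z ⟩
      adj (R i) x z xor edge (quad a b c d) x z ≡⟨ cong (adj (R i) x z xor_) (isEdge e) ⟩
      adj (R i) x z xor true                ≡⟨ xor-comm (adj (R i) x z) true ⟩
      not (adj (R i) x z)                   ∎
      where open ≡-Reasoning
    P-ab : InP R a b
    P-ab = (i , ab) , (j , trans (after (ab∈ a b c d)) (cong not ab))
    P-cd : InP R c d
    P-cd = (i , cd) , (j , trans (after (cd∈ a b c d)) (cong not cd))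
    P-ad : InP R a d
    P-ad = (j , trans (after (ad∈ a b c d)) (cong not ad)) , (i , ad)
    P-bc : InP R b c
    P-bc = (j , trans (after (bc∈ a b c d)) (cong not bc)) , (i , bc)

module Dial {m k : ℕ} (R : Fin (4 + k) → Graph m)
            (distinct : ∀ i j → i ≢ j → ¬ SameGraph (R i) (R j))
            (adjacent : ∀ i j → i ≢ j → TwoSwitchAdjacent (R i) (R j)) where

  G₀ : Graph m
  G₀ = R zero

  T₀ : Fin (3 + k) → Quad
  T₀ l = switchQuad {G = G₀} {G′ = R (suc l)} (adjacent zero (suc l) (λ ()))

  along₀ : ∀ l → SwitchedAlong G₀ (T₀ l) (R (suc l))
  along₀ l = switchQuad-along (adjacent zero (suc l) (λ ()))

  -- Opaque: the hub vertices are only ever used through the fields of Fan.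
  opaque
    fan₀ : Fan G₀ T₀
    fan₀ = fan G₀ T₀ (alternating ∘ along₀) λ l l′ l≢l′ →
            SwitchedAlong-apart (along₀ l) (along₀ l′) (distinct _ _ (l≢l′ ∘ suc-injective))
                                (adjacent _ _ (l≢l′ ∘ suc-injective))

  open Fan fan₀ public

  spoke : Fin (3 + k) → Fin m
  spoke l = OnPath.fourth (onPath l)

  N : Fin (3 + k) → Quad
  N l = quad u y v (spoke l)

  N-alternating : ∀ l → Alternating G₀ (N l)
  N-alternating l = OnPath.quad-alternating (onPath l)

  alongN : ∀ l → SwitchedAlong G₀ (N l) (R (suc l))
  alongN l = SwitchedAlong-≈ (along₀ l) (OnPath.≈quad (onPath l)) (N-alternating l)

  -- The spoke of R i: R 0 = G₀ joins u to y, and R (suc l) joins u to spoke l.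
  spokeOf : Fin (4 + k) → Fin m
  spokeOf zero    = y
  spokeOf (suc l) = spoke l

  spoke-injective : ∀ {l l′} → spoke l ≡ spoke l′ → l ≡ l′
  spoke-injective {l} {l′} eq with l ≟ l′
  ... | yes l≡l′ = l≡l′
  ... | no l≢l′  = ⊥-elim (distinct _ _ (l≢l′ ∘ suc-injective)
                    (SwitchedAlong-≈⇒SameGraph (alongN l) (alongN l′) (≈-fourth {a = u} {y} {v} eq)))

  u≢v : u ≢ v
  u≢v with N-alternating zero
  ... | (_ , u≢v , _) , _ = u≢v

  spokeOf≢u,v : ∀ i → spokeOf i ≢ u × spokeOf i ≢ v
  spokeOf≢u,v zero    with N-alternating zero
  ... | (u≢y , _ , _ , y≢v , _) , _ = ≢-sym u≢y , y≢v
  spokeOf≢u,v (suc l) with N-alternating l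
  ... | (_ , _ , u≢t , _ , _ , v≢t) , _ = ≢-sym u≢t , ≢-sym v≢t

  y≢spoke : ∀ l → y ≢ spoke l
  y≢spoke l with N-alternating l
  ... | (_ , _ , _ , _ , y≢t , _) , _ = y≢t

  adj₀-u-y : adj G₀ u y ≡ true
  adj₀-u-y with N-alternating zero
  ... | _ , uy , _ = uy

  adj₀-v-y : adj G₀ v y ≡ false
  adj₀-v-y with N-alternating zero
  ... | _ , _ , _ , _ , yv = trans (Graph.sym G₀ v y) yv

  adj₀-v-spoke : ∀ l → adj G₀ v (spoke l) ≡ true
  adj₀-v-spoke l with N-alternating l
  ... | _ , _ , vt , _ = vt

  adj₀-u-spoke : ∀ l → adj G₀ u (spoke l) ≡ false
  adj₀-u-spoke l with N-alternating l
  ... | _ , _ , _ , ut , _ = ut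

  adj-R : ∀ l x z → adj (R (suc l)) x z ≡ adj G₀ x z xor edge (N l) x z
  adj-R l = adj-xor (alongN l)

  spoke∉N : ∀ {i l} → i ≢ l → ∀ {x} → (∀ {z} → Edge (N i) x z → z ≡ y ⊎ z ≡ spoke i) →
            edge (N i) x (spoke l) ≡ false
  spoke∉N {i} {l} i≢l nb = ¬Edge⇒false λ e → [ y≢spoke l ∘ sym , i≢l ∘ sym ∘ spoke-injective ] (nb e)

  u-own : ∀ i → adj (R i) u (spokeOf i) ≡ true
  u-own zero    = adj₀-u-y
  u-own (suc i) = trans (adj-R i u (spoke i)) (cong₂ _xor_ (adj₀-u-spoke i) (isEdge (ad∈ u y v (spoke i))))

  u-other : ∀ i l → i ≢ l → adj (R i) u (spokeOf l) ≡ false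
  u-other zero    zero    0≢0 = ⊥-elim (0≢0 refl)
  u-other zero    (suc l) _   = adj₀-u-spoke l
  u-other (suc i) zero    _   = trans (adj-R i u y) (cong₂ _xor_ adj₀-u-y (isEdge (ab∈ u y v (spoke i))))
  u-other (suc i) (suc l) i≢l = trans (adj-R i u (spoke l)) (cong₂ _xor_ (adj₀-u-spoke l)
    (spoke∉N (i≢l ∘ cong suc) (neighbours₁ (proj₁ (N-alternating i)))))

  v-own : ∀ i → adj (R i) v (spokeOf i) ≡ false
  v-own zero    = adj₀-v-y
  v-own (suc i) = trans (adj-R i v (spoke i)) (cong₂ _xor_ (adj₀-v-spoke i) (isEdge (cd∈ u y v (spoke i))))

  v-other : ∀ i l → i ≢ l → adj (R i) v (spokeOf l) ≡ true
  v-other zero    zero    0≢0 = ⊥-elim (0≢0 refl)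
  v-other zero    (suc l) _   = adj₀-v-spoke l
  v-other (suc i) zero    _   = trans (adj-R i v y) (cong₂ _xor_ adj₀-v-y (isEdge (cb∈ u y v (spoke i))))
  v-other (suc i) (suc l) i≢l = trans (adj-R i v (spoke l)) (cong₂ _xor_ (adj₀-v-spoke l)
    (spoke∉N (i≢l ∘ cong suc) ([ inj₂ , inj₁ ] ∘ neighbours₃ (proj₁ (N-alternating i)))))

  other : Fin (4 + k) → Fin (4 + k)
  other zero    = suc zero
  other (suc _) = zero

  other≢ : ∀ i → other i ≢ i
  other≢ zero    ()
  other≢ (suc _) ()

  InP-u-spoke : ∀ l → InP R u (spokeOf l)
  InP-u-spoke l = (l , u-own l) , (other l , u-other (other l) l (other≢ l))

  InP-v-spoke : ∀ l → InP R v (spokeOf l)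
  InP-v-spoke l = (other l , v-other (other l) l (other≢ l)) , (l , v-own l)

  spoke∈W : ∀ l → InWminus R u v (spokeOf l)
  spoke∈W l = (u , InP-sym R (InP-u-spoke l)) , spokeOf≢u,v l

  unchanged-or-N : ∀ i a b → adj (R i) a b ≡ adj G₀ a b ⊎ ∃[ l ] Edge (N l) a b
  unchanged-or-N zero    a b = inj₁ refl
  unchanged-or-N (suc l) a b with edge? (N l) a b
  ... | inj₁ e = inj₂ (l , e)
  ... | inj₂ f = inj₁ (trans (adj-R l a b) (trans (cong (adj G₀ a b xor_) f) (xor-identityʳ (adj G₀ a b))))

  InP⇒N : ∀ {a b} → InP R a b → ∃[ l ] Edge (N l) a b
  InP⇒N {a} {b} ((i , ab) , (j , ¬ab)) with unchanged-or-N i a b | unchanged-or-N j a b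
  ... | inj₂ e | _      = e
  ... | inj₁ _ | inj₂ e = e
  ... | inj₁ p | inj₁ q = ⊥-elim (false≢true (trans (sym ¬ab) (trans q (trans (sym p) ab))))

  W⇒spoke : ∀ {z} → InWminus R u v z → ∃[ l ] z ≡ spokeOf l
  W⇒spoke ((_ , zb) , z≢u , z≢v) with InP⇒N zb
  ... | l , e with Edge⇒corner e
  ... | inj₁ z≡u               = ⊥-elim (z≢u z≡u)
  ... | inj₂ (inj₁ z≡y)        = zero , z≡y
  ... | inj₂ (inj₂ (inj₁ z≡v)) = ⊥-elim (z≢v z≡v)
  ... | inj₂ (inj₂ (inj₂ z≡t)) = suc l , z≡t

  InP⇒spoke-pair : ∀ {a b} → InP R a b →
    ∃[ w ] InWminus R u v w × (samePair a b u w ≡ true ⊎ samePair a b v w ≡ true)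
  InP⇒spoke-pair ab with InP⇒N ab
  ... | l , e = [ (λ p → y , spoke∈W zero , p) , (λ p → spoke l , spoke∈W (suc l) , p) ] (Edge⇒hub-pair e)

  spoke-pair⇒InP : ∀ {a b} →
    ∃[ w ] InWminus R u v w × (samePair a b u w ≡ true ⊎ samePair a b v w ≡ true) → InP R a b
  spoke-pair⇒InP {a} {b} (w , w∈ , s) with W⇒spoke w∈ | s
  ... | l , refl | inj₁ e = InP-SamePair R (InP-u-spoke l) (samePair⇒SamePair {x = a} {y = b} e)
  ... | l , refl | inj₂ e = InP-SamePair R (InP-v-spoke l) (samePair⇒SamePair {x = a} {y = b} e)

  isDial : IsDial R u v
  isDial = (y , InP-u-spoke zero) , (y , InP-v-spoke zero) , u≢v
         , (λ a b → mk⇔ InP⇒spoke-pair spoke-pair⇒InP) , λ i →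
           spokeOf i , spoke∈W i , u-own i , others (u-other i) , v-own i , others (v-other i)
    where
    others : ∀ {i β x} → (∀ l → i ≢ l → adj (R i) x (spokeOf l) ≡ β) →
             ∀ w → InWminus R u v w → w ≢ spokeOf i → adj (R i) x w ≡ β
    others {i} rule w w∈ w≢ with W⇒spoke w∈
    ... | l , refl = rule l (w≢ ∘ cong spokeOf ∘ sym)

theorem3 : ∀ {m} (n : ℕ) (d : Fin m → ℕ) (R : Fin n → Graph m) →
    n ≥ 4 → CliqueOfRealizations d R →
    DialExists R × (∀ i j → i ≢ j → SwitchInDial R i j)
theorem3 _ _ R (s≤s (s≤s (s≤s (s≤s _)))) (_ , distinct , adjacent) =
  (u , v , isDial) , λ i j i≢j → TwoSwitchAdjacent⇒SwitchInDial R (adjacent i j i≢j)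
  where open Dial R distinct adjacent
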